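{- (Equivalence between $\mathrm{SLT}_{\omega}$ and $\mathrm{LT}_{\omega}$.) For every formula $\alpha$, the sequent $\Rightarrow \alpha$ (empty antecedent) is derivable in $\mathrm{SLT}_{\omega}$ if and only if the sequent $\Rightarrow\alpha$ is derivable in $\mathrm{LT}_{\omega}$.
   Context: Formulas are built from countably many propositional variables $p,q,\dots$ using binary $\to,\wedge,\vee$ and unary $\neg,\mathrm{G},\mathrm{F},\mathrm{X}$. $\mathrm{X}^0\alpha := \alpha$, $\mathrm{X}^{n+1}\alpha := \mathrm{X}^n\mathrm{X}\alpha$. $\Gamma,\Delta,\Sigma,\Pi$ denote finite (possibly empty) sets of formulas; commas denote union. Derivations are well-founded, possibly infinitely branching trees. In all rules $i,k$ are arbitrary natural numbers and $p$ a propositional variable. $\mathrm{LT}_{\omega}$: sequents $\Gamma\Rightarrow\Delta$. Initial sequents $\mathrm{X}^ip\Rightarrow\mathrm{X}^ip$. Rules: (cut) from $\Gamma\Rightarrow\Delta,\alpha$ and $\alpha,\Sigma\Rightarrow\Pi$ infer $\Gamma,\Sigma\Rightarrow\Delta,\Pi$; (we-left) from $\Gamma\Rightarrow\Delta$ infer $\alpha,\Gamma\Rightarrow\Delta$; (we-right) from $\Gamma\Rightarrow\Delta$ infer $\Gamma\Rightarrow\Delta,\alpha$; ($\to$left) from $\Gamma\Rightarrow\Delta,\mathrm{X}^i\alpha$ and $\mathrm{X}^i\beta,\Gamma\Rightarrow\Delta$ infer $\mathrm{X}^i(\alpha\to\beta),\Gamma\Rightarrow\Delta$; ($\to$right) from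 $\mathrm{X}^i\alpha,\Gamma\Rightarrow\Delta,\mathrm{X}^i\beta$ infer $\Gamma\Rightarrow\Delta,\mathrm{X}^i(\alpha\to\beta)$; ($\neg$left) from $\Gamma\Rightarrow\Delta,\mathrm{X}^i\alpha$ infer $\mathrm{X}^i\neg\alpha,\Gamma\Rightarrow\Delta$; ($\neg$right) from $\mathrm{X}^i\alpha,\Gamma\Rightarrow\Delta$ infer $\Gamma\Rightarrow\Delta,\mathrm{X}^i\neg\alpha$; ($\wedge$left) from $\mathrm{X}^i\alpha,\mathrm{X}^i\beta,\Gamma\Rightarrow\Delta$ infer $\mathrm{X}^i(\alpha\wedge\beta),\Gamma\Rightarrow\Delta$; ($\wedge$right) from $\Gamma\Rightarrow\Delta,\mathrm{X}^i\alpha$ and $\Gamma\Rightarrow\Delta,\mathrm{X}^i\beta$ infer $\Gamma\Rightarrow\Delta,\mathrm{X}^i(\alpha\wedge\beta)$; ($\vee$left) from $\mathrm{X}^i\alpha,\Gamma\Rightarrow\Delta$ and $\mathrm{X}^i\beta,\Gamma\Rightarrow\Delta$ infer $\mathrm{X}^i(\alpha\vee\beta),\Gamma\Rightarrow\Delta$; ($\vee$right) from $\Gamma\Rightarrow\Delta,\mathrm{X}^i\alpha,\mathrm{X}^i\beta$ infer $\Gamma\Rightarrow\Delta,\mathrm{X}^i(\alpha\vee\beta)$; (Gleft) from $\mathrm{X}^{i+k}\alpha,\Gamma\Rightarrow\Delta$ infer $\mathrm{X}^i\mathrm{G}\alpha,\Gamma\Rightarrow\Delta$; (Gright) from all $\Gamma\Rightarrow\Delta,\mathrm{X}^{i+j}\alpha$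 ($j\in\omega$) infer $\Gamma\Rightarrow\Delta,\mathrm{X}^i\mathrm{G}\alpha$; (Fleft) from all $\mathrm{X}^{i+j}\alpha,\Gamma\Rightarrow\Delta$ ($j\in\omega$) infer $\mathrm{X}^i\mathrm{F}\alpha,\Gamma\Rightarrow\Delta$; (Fright) from $\Gamma\Rightarrow\Delta,\mathrm{X}^{i+k}\alpha$ infer $\Gamma\Rightarrow\Delta,\mathrm{X}^i\mathrm{F}\alpha$. $\mathrm{SLT}_{\omega}$: sequents $\Gamma\Rightarrow\gamma$ with $\gamma$ a single formula or empty. Initial sequents $\mathrm{X}^ip,\Gamma\Rightarrow\mathrm{X}^ip$. Rules ($\gamma$ a formula or empty): (cut) from $\Gamma\Rightarrow\alpha$ and $\alpha,\Sigma\Rightarrow\gamma$ infer $\Gamma,\Sigma\Rightarrow\gamma$; (we-right) from $\Gamma\Rightarrow$ infer $\Gamma\Rightarrow\alpha$; ($\to$left) from $\Gamma\Rightarrow\mathrm{X}^i\alpha$ and $\mathrm{X}^i\beta,\Gamma\Rightarrow\gamma$ infer $\mathrm{X}^i(\alpha\to\beta),\Gamma\Rightarrow\gamma$; ($\to$right) from $\mathrm{X}^i\alpha,\Gamma\Rightarrow\mathrm{X}^i\beta$ infer $\Gamma\Rightarrow\mathrm{X}^i(\alpha\to\beta)$; ($\neg$left) from $\Gamma\Rightarrow\mathrm{X}^i\alpha$ infer $\mathrm{X}^i\neg\alpha,\Gamma\Rightarrow$; ($\neg$right) from $\mathrm{X}^i\alpha,\Gamma\Rightarrow$ infer $\Gamma\Rightarrow\mathrm{X}^i\neg\alpha$;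 (ex-middle) from $\mathrm{X}^i\neg\alpha,\Gamma\Rightarrow\gamma$ and $\mathrm{X}^i\alpha,\Gamma\Rightarrow\gamma$ infer $\Gamma\Rightarrow\gamma$; ($\wedge$left) from $\mathrm{X}^i\alpha,\mathrm{X}^i\beta,\Gamma\Rightarrow\gamma$ infer $\mathrm{X}^i(\alpha\wedge\beta),\Gamma\Rightarrow\gamma$; ($\wedge$right) from $\Gamma\Rightarrow\mathrm{X}^i\alpha$ and $\Gamma\Rightarrow\mathrm{X}^i\beta$ infer $\Gamma\Rightarrow\mathrm{X}^i(\alpha\wedge\beta)$; ($\vee$left) from $\mathrm{X}^i\alpha,\Gamma\Rightarrow\gamma$ and $\mathrm{X}^i\beta,\Gamma\Rightarrow\gamma$ infer $\mathrm{X}^i(\alpha\vee\beta),\Gamma\Rightarrow\gamma$; ($\vee$right1/2) from $\Gamma\Rightarrow\mathrm{X}^i\alpha$ (resp. $\Gamma\Rightarrow\mathrm{X}^i\beta$) infer $\Gamma\Rightarrow\mathrm{X}^i(\alpha\vee\beta)$; (Gleft) from $\mathrm{X}^{i+k}\alpha,\Gamma\Rightarrow\gamma$ infer $\mathrm{X}^i\mathrm{G}\alpha,\Gamma\Rightarrow\gamma$; (Gright) from all $\Gamma\Rightarrow\mathrm{X}^{i+j}\alpha$ ($j\in\omega$) infer $\Gamma\Rightarrow\mathrm{X}^i\mathrm{G}\alpha$; (Fleft) from all $\mathrm{X}^{i+j}\alpha,\Gamma\Rightarrow\gamma$ ($j\in\omega$) infer $\mathrm{X}^i\mathrm{F}\alpha,\Gamma\Rightarrow\gamma$;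 (Fright) from $\Gamma\Rightarrow\mathrm{X}^{i+k}\alpha$ infer $\Gamma\Rightarrow\mathrm{X}^i\mathrm{F}\alpha$. -}

module Defs where

open import Data.Nat using (ℕ; zero; suc; _+_)
open import Data.List using (List; []; _∷_; _++_)
open import Data.List.Membership.Propositional using (_∈_)
open import Data.Maybe using (Maybe; just; nothing)
open import Data.Product using (_×_)

data Fm : Set where
  var  : ℕ → Fm
  _⇒_  : Fm → Fm → Fm
  _∧_  : Fm → Fm → Fm
  _∨_  : Fm → Fm → Fm
  ¬_   : Fm → Fm
  G    : Fm → Fm
  F    : Fm → Fm
  X    : Fm → Fm

X^ : ℕ → Fm → Fm
X^ zero    a = a
X^ (suc n) a = X^ n (X a)

-- Finite sets of formulas are represented by lists, identified up to
-- having the same elements (see the `set` rules below).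
Ctx : Set
Ctx = List Fm

_⊆_ : Ctx → Ctx → Set
Γ ⊆ Δ = ∀ {a} → a ∈ Γ → a ∈ Δ

_≋_ : Ctx → Ctx → Set
Γ ≋ Δ = (Γ ⊆ Δ) × (Δ ⊆ Γ)

infixr 5 _,,_
_,,_ : Fm → Ctx → Ctx
a ,, Γ = a ∷ Γ

data LT : Ctx → Ctx → Set where
  set    : ∀ {Γ Γ' Δ Δ'} → Γ ≋ Γ' → Δ ≋ Δ' → LT Γ Δ → LT Γ' Δ'
  init   : ∀ i p → LT (X^ i (var p) ∷ []) (X^ i (var p) ∷ [])
  cut    : ∀ {Γ Δ Σ Π} a → LT Γ (Δ ++ a ∷ []) → LT (a ∷ Σ) Π → LT (Γ ++ Σ) (Δ ++ Π)
  weL    : ∀ {Γ Δ} a → LT Γ Δ → LT (a ∷ Γ) Δ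
  weR    : ∀ {Γ Δ} a → LT Γ Δ → LT Γ (Δ ++ a ∷ [])
  ⇒L     : ∀ {Γ Δ} i a b → LT Γ (Δ ++ X^ i a ∷ []) → LT (X^ i b ∷ Γ) Δ
           → LT (X^ i (a ⇒ b) ∷ Γ) Δ
  ⇒R     : ∀ {Γ Δ} i a b → LT (X^ i a ∷ Γ) (Δ ++ X^ i b ∷ [])
           → LT Γ (Δ ++ X^ i (a ⇒ b) ∷ [])
  ¬L     : ∀ {Γ Δ} i a → LT Γ (Δ ++ X^ i a ∷ []) → LT (X^ i (¬ a) ∷ Γ) Δ
  ¬R     : ∀ {Γ Δ} i a → LT (X^ i a ∷ Γ) Δ → LT Γ (Δ ++ X^ i (¬ a) ∷ [])
  ∧L     : ∀ {Γ Δ} i a b → LT (X^ i a ∷ X^ i b ∷ Γ) Δ → LT (X^ i (a ∧ b) ∷ Γ) Δ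
  ∧R     : ∀ {Γ Δ} i a b → LT Γ (Δ ++ X^ i a ∷ []) → LT Γ (Δ ++ X^ i b ∷ [])
           → LT Γ (Δ ++ X^ i (a ∧ b) ∷ [])
  ∨L     : ∀ {Γ Δ} i a b → LT (X^ i a ∷ Γ) Δ → LT (X^ i b ∷ Γ) Δ
           → LT (X^ i (a ∨ b) ∷ Γ) Δ
  ∨R     : ∀ {Γ Δ} i a b → LT Γ (Δ ++ X^ i a ∷ X^ i b ∷ [])
           → LT Γ (Δ ++ X^ i (a ∨ b) ∷ [])
  GL     : ∀ {Γ Δ} i k a → LT (X^ (i + k) a ∷ Γ) Δ → LT (X^ i (G a) ∷ Γ) Δ
  GR     : ∀ {Γ Δ} i a → (∀ j → LT Γ (Δ ++ X^ (i + j) a ∷ []))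
           → LT Γ (Δ ++ X^ i (G a) ∷ [])
  FL     : ∀ {Γ Δ} i a → (∀ j → LT (X^ (i + j) a ∷ Γ) Δ) → LT (X^ i (F a) ∷ Γ) Δ
  FR     : ∀ {Γ Δ} i k a → LT Γ (Δ ++ X^ (i + k) a ∷ [])
           → LT Γ (Δ ++ X^ i (F a) ∷ [])

-- SLT_ω : derivable sequents Γ ⇒ γ, with γ a formula (just) or empty (nothing)
Suc : Set
Suc = Maybe Fm

data SLT : Ctx → Suc → Set where
  set    : ∀ {Γ Γ' γ} → Γ ≋ Γ' → SLT Γ γ → SLT Γ' γ
  init   : ∀ {Γ} i p → SLT (X^ i (var p) ∷ Γ) (just (X^ i (var p)))
  cut    : ∀ {Γ Σ γ} a → SLT Γ (just a) → SLT (a ∷ Σ) γ → SLT (Γ ++ Σ) γ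
  weR    : ∀ {Γ} a → SLT Γ nothing → SLT Γ (just a)
  ⇒L     : ∀ {Γ γ} i a b → SLT Γ (just (X^ i a)) → SLT (X^ i b ∷ Γ) γ
           → SLT (X^ i (a ⇒ b) ∷ Γ) γ
  ⇒R     : ∀ {Γ} i a b → SLT (X^ i a ∷ Γ) (just (X^ i b))
           → SLT Γ (just (X^ i (a ⇒ b)))
  ¬L     : ∀ {Γ} i a → SLT Γ (just (X^ i a)) → SLT (X^ i (¬ a) ∷ Γ) nothing
  ¬R     : ∀ {Γ} i a → SLT (X^ i a ∷ Γ) nothing → SLT Γ (just (X^ i (¬ a)))
  exm    : ∀ {Γ γ} i a → SLT (X^ i (¬ a) ∷ Γ) γ → SLT (X^ i a ∷ Γ) γ → SLT Γ γ
  ∧L     : ∀ {Γ γ} i a b → SLT (X^ i a ∷ X^ i b ∷ Γ) γ → SLT (X^ i (a ∧ b) ∷ Γ) γ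
  ∧R     : ∀ {Γ} i a b → SLT Γ (just (X^ i a)) → SLT Γ (just (X^ i b))
           → SLT Γ (just (X^ i (a ∧ b)))
  ∨L     : ∀ {Γ γ} i a b → SLT (X^ i a ∷ Γ) γ → SLT (X^ i b ∷ Γ) γ
           → SLT (X^ i (a ∨ b) ∷ Γ) γ
  ∨R1    : ∀ {Γ} i a b → SLT Γ (just (X^ i a)) → SLT Γ (just (X^ i (a ∨ b)))
  ∨R2    : ∀ {Γ} i a b → SLT Γ (just (X^ i b)) → SLT Γ (just (X^ i (a ∨ b)))
  GL     : ∀ {Γ γ} i k a → SLT (X^ (i + k) a ∷ Γ) γ → SLT (X^ i (G a) ∷ Γ) γ
  GR     : ∀ {Γ} i a → (∀ j → SLT Γ (just (X^ (i + j) a)))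
           → SLT Γ (just (X^ i (G a)))
  FL     : ∀ {Γ γ} i a → (∀ j → SLT (X^ (i + j) a ∷ Γ) γ) → SLT (X^ i (F a) ∷ Γ) γ
  FR     : ∀ {Γ} i k a → SLT Γ (just (X^ (i + k) a))
           → SLT Γ (just (X^ i (F a)))

{-# OPTIONS --safe #-}
-- Reading the SLT succedent as a list of at most one formula, each SLT rule is, up to
-- weakening, an instance of the corresponding LT rule; excluded middle is a cut on X^i ¬a
-- followed by contraction. Conversely, an LT derivation of Γ ⇒ Δ yields an SLT refutation
-- of Γ together with the negations of Δ: a succedent formula c is recovered from a
-- refutation of ¬c by excluded middle (reductio ad absurdum), and a cut on a becomes
-- excluded middle on a. Refuting every Θ that merely contains Γ and ¬Δ builds in the left
-- weakening that SLT lacks.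
module Submission where

open import Defs
open import Data.List using ([]; _∷_; _++_; fromMaybe)
open import Data.List.Membership.Propositional using (_∈_)
open import Data.List.Membership.Propositional.Properties using (∈-++⁺ˡ; ∈-++⁺ʳ; ∈-++⁻)
open import Data.List.Relation.Unary.Any using (here; there)
open import Data.List.Relation.Binary.Permutation.Propositional using (_↭_; ↭-refl; ↭-sym; ↭-swap)
open import Data.List.Relation.Binary.Permutation.Propositional.Properties using (++-comm)
open import Data.List.Relation.Binary.Subset.Propositional.Properties using (⊆-reflexive-↭; xs⊆ys++xs; ∷⁺ʳ)
open import Data.Maybe using (just; nothing)
open import Data.Nat using (suc; _+_)
open import Data.Product using (_×_; _,_)
open import Data.Sum using ([_,_]′)
open import Function using (id; _∘_)
open import Relation.Binary.PropositionalEquality using (refl)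

private variable
  Γ Δ Θ Σ : Ctx
  a b c : Fm
  γ : Suc

≋-refl : Γ ≋ Γ
≋-refl = id , id

↭⇒≋ : Γ ↭ Δ → Γ ≋ Δ
↭⇒≋ p = ⊆-reflexive-↭ p , ⊆-reflexive-↭ (↭-sym p)

⊆⇒++-≋ : Γ ⊆ Θ → (Γ ++ Θ) ≋ Θ
⊆⇒++-≋ {Γ} {Θ} Γ⊆Θ = [ Γ⊆Θ , id ]′ ∘ ∈-++⁻ Γ , xs⊆ys++xs Θ Γ

swap-≋ : (a ∷ b ∷ Γ) ≋ (b ∷ a ∷ Γ)
swap-≋ = ↭⇒≋ (↭-swap _ _ ↭-refl)

LT-weakenˡ : ∀ Σ → LT Γ Δ → LT (Σ ++ Γ) Δ
LT-weakenˡ []      d = d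
LT-weakenˡ (a ∷ Σ) d = weL a (LT-weakenˡ Σ d)

LT-weakenʳ-∷ : ∀ c → LT Γ Δ → LT Γ (c ∷ Δ)
LT-weakenʳ-∷ {Δ = Δ} c d = set ≋-refl (↭⇒≋ (++-comm Δ (c ∷ []))) (weR c d)

LT-weakenʳ-fromMaybe : ∀ γ → LT Γ Δ → LT Γ (fromMaybe γ ++ Δ)
LT-weakenʳ-fromMaybe nothing  d = d
LT-weakenʳ-fromMaybe (just c) d = LT-weakenʳ-∷ c d

SLT⇒LT : SLT Γ γ → LT Γ (fromMaybe γ)
SLT⇒LT (set e d)             = set e ≋-refl (SLT⇒LT d)
SLT⇒LT {Γ = _ ∷ Γ} (init i p) =
  set (↭⇒≋ (++-comm Γ _)) ≋-refl (LT-weakenˡ Γ (init i p))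
SLT⇒LT (cut a d₁ d₂)         = cut a (SLT⇒LT d₁) (SLT⇒LT d₂)
SLT⇒LT (weR a d)             = weR a (SLT⇒LT d)
SLT⇒LT {γ = γ} (⇒L i a b d₁ d₂) =
  ⇒L i a b (LT-weakenʳ-fromMaybe γ (SLT⇒LT d₁)) (SLT⇒LT d₂)
SLT⇒LT (⇒R i a b d)          = ⇒R {Δ = []} i a b (SLT⇒LT d)
SLT⇒LT (¬L i a d)            = ¬L {Δ = []} i a (SLT⇒LT d)
SLT⇒LT (¬R i a d)            = ¬R {Δ = []} i a (SLT⇒LT d)
SLT⇒LT (exm i a d₁ d₂)       =
  set (⊆⇒++-≋ id) (⊆⇒++-≋ id) (cut (X^ i (¬ a)) (¬R i a (SLT⇒LT d₂)) (SLT⇒LT d₁))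
SLT⇒LT (∧L i a b d)          = ∧L i a b (SLT⇒LT d)
SLT⇒LT (∧R i a b d₁ d₂)      = ∧R {Δ = []} i a b (SLT⇒LT d₁) (SLT⇒LT d₂)
SLT⇒LT (∨L i a b d₁ d₂)      = ∨L i a b (SLT⇒LT d₁) (SLT⇒LT d₂)
SLT⇒LT (∨R1 i a b d)         = ∨R {Δ = []} i a b (weR (X^ i b) (SLT⇒LT d))
SLT⇒LT (∨R2 i a b d)         = ∨R {Δ = []} i a b (LT-weakenʳ-∷ (X^ i a) (SLT⇒LT d))
SLT⇒LT (GL i k a d)          = GL i k a (SLT⇒LT d)
SLT⇒LT (GR i a f)            = GR {Δ = []} i a (SLT⇒LT ∘ f)
SLT⇒LT (FL i a f)            = FL i a (SLT⇒LT ∘ f)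
SLT⇒LT (FR i k a d)          = FR {Δ = []} i k a (SLT⇒LT d)

SLT-identity : ∀ i a → SLT (X^ i a ∷ Γ) (just (X^ i a))
SLT-identity i (var p) = init i p
SLT-identity i (a ⇒ b) =
  ⇒R i a b (set swap-≋ (⇒L i a b (SLT-identity i a) (SLT-identity i b)))
SLT-identity i (a ∧ b) =
  ∧R i a b (∧L i a b (SLT-identity i a)) (∧L i a b (set swap-≋ (SLT-identity i b)))
SLT-identity i (a ∨ b) =
  ∨L i a b (∨R1 i a b (SLT-identity i a)) (∨R2 i a b (SLT-identity i b))
SLT-identity i (¬ a)   = ¬R i a (set swap-≋ (¬L i a (SLT-identity i a)))
SLT-identity i (G a)   = GR i a λ j → GL i j a (SLT-identity (i + j) a)
SLT-identity i (F a)   = FL i a λ j → FR i j a (SLT-identity (i + j) a)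
SLT-identity i (X a)   = SLT-identity (suc i) a

SLT-contract : a ∈ Γ → SLT (a ∷ Γ) γ → SLT Γ γ
SLT-contract a∈Γ = set (⊆⇒++-≋ λ { (here refl) → a∈Γ })

SLT-¬-elim : (¬ a) ∈ Γ → SLT Γ (just a) → SLT Γ nothing
SLT-¬-elim ¬a∈Γ d = SLT-contract ¬a∈Γ (¬L 0 _ d)

SLT-raa : SLT (¬ a ∷ Γ) nothing → SLT Γ (just a)
SLT-raa {a} d = exm 0 a (weR a d) (SLT-identity 0 a)

SLT-¬∨-elim : ∀ i → (¬ X^ i (a ∨ b)) ∈ Γ →
              SLT (¬ X^ i b ∷ ¬ X^ i a ∷ Γ) nothing → SLT Γ nothing
SLT-¬∨-elim {a} {b} i ¬a∨b∈Γ d =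
  exm 0 (X^ i a)
    (exm 0 (X^ i b) d (SLT-¬-elim (there (there ¬a∨b∈Γ)) (∨R2 i a b (SLT-identity i b))))
    (SLT-¬-elim (there ¬a∨b∈Γ) (∨R1 i a b (SLT-identity i a)))

infix 4 ¬[_]⊆_
¬[_]⊆_ : Ctx → Ctx → Set
¬[ Δ ]⊆ Θ = ∀ {a} → a ∈ Δ → (¬ a) ∈ Θ

¬[]⊆-++⁺ : ¬[ Δ ]⊆ Θ → ¬[ Σ ]⊆ Θ → ¬[ Δ ++ Σ ]⊆ Θ
¬[]⊆-++⁺ {Δ} hΔ hΣ = [ hΔ , hΣ ]′ ∘ ∈-++⁻ Δ

¬[]⊆-++⁻ˡ : ¬[ Δ ++ Σ ]⊆ Θ → ¬[ Δ ]⊆ Θ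
¬[]⊆-++⁻ˡ h = h ∘ ∈-++⁺ˡ

¬[]⊆-++⁻ʳ : ∀ Δ → ¬[ Δ ++ Σ ]⊆ Θ → ¬[ Σ ]⊆ Θ
¬[]⊆-++⁻ʳ Δ h = h ∘ ∈-++⁺ʳ Δ

¬[]⊆-∷ʳ⁻ : ∀ Δ → ¬[ Δ ++ c ∷ [] ]⊆ Θ → (¬ c) ∈ Θ
¬[]⊆-∷ʳ⁻ Δ h = ¬[]⊆-++⁻ʳ Δ h (here refl)

¬[]⊆-∷ʳ : ¬[ Δ ]⊆ Θ → ¬[ Δ ++ c ∷ [] ]⊆ (¬ c ∷ Θ)
¬[]⊆-∷ʳ hΔ = ¬[]⊆-++⁺ (there ∘ hΔ) λ { (here refl) → here refl }

mutual
  LT⇒SLT : LT Γ Δ → Γ ⊆ Θ → ¬[ Δ ]⊆ Θ → SLT Θ nothing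
  LT⇒SLT (set (Γ⊆Γ′ , _) (Δ⊆Δ′ , _) d) hΓ hΔ = LT⇒SLT d (hΓ ∘ Γ⊆Γ′) (hΔ ∘ Δ⊆Δ′)
  LT⇒SLT (init i p) hΓ hΔ =
    SLT-¬-elim (hΔ (here refl)) (SLT-contract (hΓ (here refl)) (init i p))
  LT⇒SLT (cut {Γ} {Δ} a d₁ d₂) hΓ hΔ =
    exm 0 a (LT⇒SLT d₁ (there ∘ hΓ ∘ ∈-++⁺ˡ) (¬[]⊆-∷ʳ (¬[]⊆-++⁻ˡ hΔ)))
            (LT⇒SLTˡ d₂ (hΓ ∘ ∈-++⁺ʳ Γ) (¬[]⊆-++⁻ʳ Δ hΔ))
  LT⇒SLT (weL a d) hΓ hΔ = LT⇒SLT d (hΓ ∘ there) hΔ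
  LT⇒SLT (weR a d) hΓ hΔ = LT⇒SLT d hΓ (¬[]⊆-++⁻ˡ hΔ)
  LT⇒SLT (⇒L i a b d₁ d₂) hΓ hΔ = SLT-contract (hΓ (here refl))
    (⇒L i a b (LT⇒SLTʳ d₁ (hΓ ∘ there) hΔ) (LT⇒SLTˡ d₂ (hΓ ∘ there) hΔ))
  LT⇒SLT (⇒R {Δ = Δ} i a b d) hΓ hΔ = SLT-¬-elim (¬[]⊆-∷ʳ⁻ Δ hΔ)
    (⇒R i a b (LT⇒SLTʳ d (∷⁺ʳ _ hΓ) (there ∘ ¬[]⊆-++⁻ˡ hΔ)))
  LT⇒SLT (¬L i a d) hΓ hΔ = SLT-contract (hΓ (here refl))
    (¬L i a (LT⇒SLTʳ d (hΓ ∘ there) hΔ))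
  LT⇒SLT (¬R {Δ = Δ} i a d) hΓ hΔ = SLT-¬-elim (¬[]⊆-∷ʳ⁻ Δ hΔ)
    (¬R i a (LT⇒SLTˡ d hΓ (¬[]⊆-++⁻ˡ hΔ)))
  LT⇒SLT (∧L i a b d) hΓ hΔ = SLT-contract (hΓ (here refl))
    (∧L i a b (LT⇒SLT d (∷⁺ʳ _ (∷⁺ʳ _ (hΓ ∘ there))) (there ∘ there ∘ hΔ)))
  LT⇒SLT (∧R {Δ = Δ} i a b d₁ d₂) hΓ hΔ = SLT-¬-elim (¬[]⊆-∷ʳ⁻ Δ hΔ)
    (∧R i a b (LT⇒SLTʳ d₁ hΓ (¬[]⊆-++⁻ˡ hΔ))
              (LT⇒SLTʳ d₂ hΓ (¬[]⊆-++⁻ˡ hΔ)))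
  LT⇒SLT (∨L i a b d₁ d₂) hΓ hΔ = SLT-contract (hΓ (here refl))
    (∨L i a b (LT⇒SLTˡ d₁ (hΓ ∘ there) hΔ) (LT⇒SLTˡ d₂ (hΓ ∘ there) hΔ))
  LT⇒SLT (∨R {Δ = Δ} i a b d) hΓ hΔ = SLT-¬∨-elim i (¬[]⊆-∷ʳ⁻ Δ hΔ)
    (LT⇒SLT d (there ∘ there ∘ hΓ)
      (¬[]⊆-++⁺ {Δ} (there ∘ there ∘ ¬[]⊆-++⁻ˡ {Δ} hΔ)
                λ { (here refl) → there (here refl) ; (there (here refl)) → here refl }))
  LT⇒SLT (GL i k a d) hΓ hΔ = SLT-contract (hΓ (here refl))
    (GL i k a (LT⇒SLTˡ d (hΓ ∘ there) hΔ))
  LT⇒SLT (GR {Δ = Δ} i a f) hΓ hΔ = SLT-¬-elim (¬[]⊆-∷ʳ⁻ Δ hΔ)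
    (GR i a λ j → LT⇒SLTʳ (f j) hΓ (¬[]⊆-++⁻ˡ hΔ))
  LT⇒SLT (FL i a f) hΓ hΔ = SLT-contract (hΓ (here refl))
    (FL i a λ j → LT⇒SLTˡ (f j) (hΓ ∘ there) hΔ)
  LT⇒SLT (FR {Δ = Δ} i k a d) hΓ hΔ = SLT-¬-elim (¬[]⊆-∷ʳ⁻ Δ hΔ)
    (FR i k a (LT⇒SLTʳ d hΓ (¬[]⊆-++⁻ˡ hΔ)))

  LT⇒SLTˡ : LT (a ∷ Γ) Δ → Γ ⊆ Θ → ¬[ Δ ]⊆ Θ → SLT (a ∷ Θ) nothing
  LT⇒SLTˡ d hΓ hΔ = LT⇒SLT d (∷⁺ʳ _ hΓ) (there ∘ hΔ)

  LT⇒SLTʳ : LT Γ (Δ ++ c ∷ []) → Γ ⊆ Θ → ¬[ Δ ]⊆ Θ → SLT Θ (just c)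
  LT⇒SLTʳ d hΓ hΔ = SLT-raa (LT⇒SLT d (there ∘ hΓ) (¬[]⊆-∷ʳ hΔ))

theorem2 : ∀ (a : Fm) → (SLT [] (just a) → LT [] (a ∷ [])) × (LT [] (a ∷ []) → SLT [] (just a))
theorem2 a = SLT⇒LT , λ d → LT⇒SLTʳ {Δ = []} d (λ ()) (λ ())
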